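{- For all integers $m,n$ with $1<m\le n$, $T'(n,m) = D(n,m) + D(n-1,m)$.
   Context: For positive integers $n,m$, $D(n,m)$ denotes the number of partitions of $n$ whose largest part is exactly $m$, so $D(n,m)=0$ if $m>n$. Equivalently, $D(n,n)=D(n,1)=1$ and $D(n,m)=\sum_{x=1}^{\min(m,n-m)}D(n-m,x)$ for $1<m<n$. For integers $1\le m\le n$, $T'(n,m)$ is defined by $T'(n,n)=T'(n,1)=1$ and, for $1<m<n$, \[ T'(n,m)=1+\sum_{x=1}^{\min(m,n-m)}T'(n-m,x). \] This is the number of invocations of Ruskey's recursive procedure $\mathrm{RecDesc}(n,m,k)$ needed to generate all descending compositions of $n$ with first part exactly $m$. -}

module Defs where

open import Data.Nat using (ℕ; zero; suc; _+_; _∸_; _⊓_; _≤ᵇ_; _≡ᵇ_)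
open import Data.Bool using (if_then_else_)

sumFrom1 : ℕ → (ℕ → ℕ) → ℕ
sumFrom1 zero    f = 0
sumFrom1 (suc k) f = sumFrom1 k f + f (suc k)

-- With fuel ≥ n the fuel
-- never runs out (each recursive call is at n ∸ m < n since m ≥ 2), so the
-- fuel only serves to make termination evident to Agda.
Dfuel : ℕ → ℕ → ℕ → ℕ
Dfuel zero       n m = 0
Dfuel (suc fuel) n zero = 0
Dfuel (suc fuel) n (suc zero) = if 1 ≤ᵇ n then 1 else 0
Dfuel (suc fuel) n m@(suc (suc _)) =
  if m ≡ᵇ n then 1
  else if n ≤ᵇ m then 0
  else sumFrom1 (m ⊓ (n ∸ m)) (λ x → Dfuel fuel (n ∸ m) x)

D : ℕ → ℕ → ℕ
D n m = Dfuel (suc n) n m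

--   T'(n,m): T'(n,n) = T'(n,1) = 1,
--            T'(n,m) = 1 + Σ_{x=1}^{min(m,n-m)} T'(n-m,x) for 1 < m < n.
-- (Values outside 1 ≤ m ≤ n are set to 0; they are never used for such
-- arguments by the recursion nor by the statement.)
T'fuel : ℕ → ℕ → ℕ → ℕ
T'fuel zero       n m = 0
T'fuel (suc fuel) n zero = 0
T'fuel (suc fuel) n (suc zero) = if 1 ≤ᵇ n then 1 else 0
T'fuel (suc fuel) n m@(suc (suc _)) =
  if m ≡ᵇ n then 1
  else if n ≤ᵇ m then 0
  else 1 + sumFrom1 (m ⊓ (n ∸ m)) (λ x → T'fuel fuel (n ∸ m) x)

T' : ℕ → ℕ → ℕ
T' n m = T'fuel (suc n) n m

module Submission where

-- The diagonal m = n is immediate: T'(n,n) = D(n,n) = 1 and D(n-1,n) = 0.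
-- Otherwise write n = m + (1 + r). Unfolding the recursions once,
--   T'(n,m) = 1 + Σ_{x=1}^{k} T'(1+r,x),   D(n,m) = Σ_{x=1}^{k} D(1+r,x),
-- with k = min(m, 1+r). By induction T'(1+r,x) = D(1+r,x) + D(r,x) for x ≥ 2,
-- while T'(1+r,1) = D(1+r,1) = 1, so
--   T'(n,m) = D(n,m) + (1 + Σ_{x=2}^{k} D(r,x)).
-- The bracket equals D(n-1,m) = D(m+r,m): for r = 0 both are 1, and for
-- r ≥ 1 the recursion gives Σ_{x=1}^{min(m,r)} D(r,x), whose first term is
-- D(r,1) = 1 and whose range may be extended to k since D(r,r+1) = 0.

open import Defs
open import Data.Nat using (ℕ; zero; suc; _+_; _∸_; _⊓_; _≡ᵇ_; _≤ᵇ_; _<_; _≤_; s≤s; z≤n)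
open import Data.Nat.Properties
open import Data.Nat.Induction using (<-rec)
open import Data.Bool using (Bool; true; false; T)
open import Data.Product using (_,_)
open import Data.Sum using (inj₁; inj₂)
open import Data.Unit using (tt)
open import Data.Empty using (⊥-elim)
open import Function using (_∘_)
open import Relation.Nullary using (¬_)
open import Relation.Binary.PropositionalEquality
  using (_≡_; _≢_; ≢-sym; refl; sym; trans; cong; cong₂; module ≡-Reasoning)
open import Algebra.Properties.CommutativeSemigroup +-commutativeSemigroup
  using (interchange)

open ≡-Reasoning

T⇒≡true : ∀ {b : Bool} → T b → b ≡ true
T⇒≡true {true} _ = refl

¬T⇒≡false : ∀ {b : Bool} → ¬ T b → b ≡ false
¬T⇒≡false {false} _  = refl
¬T⇒≡false {true}  ¬t = ⊥-elim (¬t tt)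

≡ᵇ-refl : ∀ a → (a ≡ᵇ a) ≡ true
≡ᵇ-refl a = T⇒≡true (≡⇒≡ᵇ a a refl)

≢⇒≡ᵇ-false : ∀ {a b} → a ≢ b → (a ≡ᵇ b) ≡ false
≢⇒≡ᵇ-false {a} {b} a≢b = ¬T⇒≡false (a≢b ∘ ≡ᵇ⇒≡ a b)

≤⇒≤ᵇ-true : ∀ {a b} → a ≤ b → (a ≤ᵇ b) ≡ true
≤⇒≤ᵇ-true a≤b = T⇒≡true (≤⇒≤ᵇ a≤b)

>⇒≤ᵇ-false : ∀ {a b} → b < a → (a ≤ᵇ b) ≡ false
>⇒≤ᵇ-false {a} {b} b<a = ¬T⇒≡false (<⇒≱ b<a ∘ ≤ᵇ⇒≤ a b)

sum-cong : ∀ k (f g : ℕ → ℕ) → (∀ x → 1 ≤ x → x ≤ k → f x ≡ g x) →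
           sumFrom1 k f ≡ sumFrom1 k g
sum-cong zero    f g f≗g = refl
sum-cong (suc k) f g f≗g =
  cong₂ _+_ (sum-cong k f g (λ x 1≤x x≤k → f≗g x 1≤x (m≤n⇒m≤1+n x≤k)))
            (f≗g (suc k) (s≤s z≤n) ≤-refl)

sum-+ : ∀ k (f g : ℕ → ℕ) →
        sumFrom1 k (λ x → f x + g x) ≡ sumFrom1 k f + sumFrom1 k g
sum-+ zero    f g = refl
sum-+ (suc k) f g = begin
  sumFrom1 k (λ x → f x + g x) + (f (suc k) + g (suc k))
    ≡⟨ cong (_+ (f (suc k) + g (suc k))) (sum-+ k f g) ⟩
  (sumFrom1 k f + sumFrom1 k g) + (f (suc k) + g (suc k))
    ≡⟨ interchange (sumFrom1 k f) (sumFrom1 k g) (f (suc k)) (g (suc k)) ⟩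
  sumFrom1 (suc k) f + sumFrom1 (suc k) g
    ∎

sum-extend : ∀ (f : ℕ → ℕ) k j → k ≤ j → (∀ x → k < x → x ≤ j → f x ≡ 0) →
             sumFrom1 j f ≡ sumFrom1 k f
sum-extend f k zero    z≤n  _      = refl
sum-extend f k (suc j) k≤1+j vanish with m≤n⇒m<n∨m≡n k≤1+j
... | inj₂ refl = refl
... | inj₁ (s≤s k≤j) = begin
  sumFrom1 j f + f (suc j) ≡⟨ cong₂ _+_ extend-to-j (vanish (suc j) (s≤s k≤j) ≤-refl) ⟩
  sumFrom1 k f + 0         ≡⟨ +-identityʳ _ ⟩
  sumFrom1 k f             ∎
  where
  extend-to-j : sumFrom1 j f ≡ sumFrom1 k f
  extend-to-j = sum-extend f k j k≤j (λ x k<x x≤j → vanish x k<x (m≤n⇒m≤1+n x≤j))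

-- f with its value at 1 replaced by 0, so that
-- Σ_{x=1}^{k} dropFirst f x = Σ_{x=2}^{k} f x.
dropFirst : (ℕ → ℕ) → ℕ → ℕ
dropFirst f (suc zero) = 0
dropFirst f x          = f x

sum-split-first : ∀ k (f : ℕ → ℕ) → 1 ≤ k →
                  sumFrom1 k f ≡ f 1 + sumFrom1 k (dropFirst f)
sum-split-first (suc zero)    f _ = sym (+-identityʳ (f 1))
sum-split-first (suc (suc k)) f _ = begin
  sumFrom1 (suc k) f + f (2 + k)
    ≡⟨ cong (_+ f (2 + k)) (sum-split-first (suc k) f (s≤s z≤n)) ⟩
  (f 1 + sumFrom1 (suc k) (dropFirst f)) + f (2 + k)
    ≡⟨ +-assoc (f 1) _ _ ⟩
  f 1 + sumFrom1 (suc (suc k)) (dropFirst f)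
    ∎

Dfuel-irrelevant : ∀ f g n m → n < f → n < g → Dfuel f n m ≡ Dfuel g n m
Dfuel-irrelevant (suc f) (suc g) n zero _ _ = refl
Dfuel-irrelevant (suc f) (suc g) n (suc zero) _ _ = refl
Dfuel-irrelevant (suc f) (suc g) zero (suc (suc j)) _ _ = refl
Dfuel-irrelevant (suc f) (suc g) n@(suc n′) m@(suc (suc j)) n<1+f n<1+g
  with m ≡ᵇ n | n ≤ᵇ m
... | true  | _     = refl
... | false | true  = refl
... | false | false = sum-cong (m ⊓ (n ∸ m)) _ _ λ x _ _ →
  Dfuel-irrelevant f g (n ∸ m) x (≤-trans n∸m<n (≤-pred n<1+f)) (≤-trans n∸m<n (≤-pred n<1+g))
  where
  n∸m<n : n ∸ m < n
  n∸m<n = s≤s (m∸n≤m n′ (suc j))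

T'fuel-irrelevant : ∀ f g n m → n < f → n < g → T'fuel f n m ≡ T'fuel g n m
T'fuel-irrelevant (suc f) (suc g) n zero _ _ = refl
T'fuel-irrelevant (suc f) (suc g) n (suc zero) _ _ = refl
T'fuel-irrelevant (suc f) (suc g) zero (suc (suc j)) _ _ = refl
T'fuel-irrelevant (suc f) (suc g) n@(suc n′) m@(suc (suc j)) n<1+f n<1+g
  with m ≡ᵇ n | n ≤ᵇ m
... | true  | _     = refl
... | false | true  = refl
... | false | false = cong suc (sum-cong (m ⊓ (n ∸ m)) _ _ λ x _ _ →
  T'fuel-irrelevant f g (n ∸ m) x (≤-trans n∸m<n (≤-pred n<1+f)) (≤-trans n∸m<n (≤-pred n<1+g)))
  where
  n∸m<n : n ∸ m < n
  n∸m<n = s≤s (m∸n≤m n′ (suc j))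

D-unfold : ∀ n m → 1 < m → m < n → D n m ≡ sumFrom1 (m ⊓ (n ∸ m)) (D (n ∸ m))
D-unfold n (suc zero) (s≤s ()) _
D-unfold n m@(suc (suc _)) _ m<n
  rewrite ≢⇒≡ᵇ-false (<⇒≢ m<n) | >⇒≤ᵇ-false m<n =
  sum-cong (m ⊓ (n ∸ m)) _ _ λ x _ _ →
    Dfuel-irrelevant n (suc (n ∸ m)) (n ∸ m) x (∸-monoʳ-< (s≤s z≤n) (<⇒≤ m<n)) ≤-refl

T'-unfold : ∀ n m → 1 < m → m < n → T' n m ≡ 1 + sumFrom1 (m ⊓ (n ∸ m)) (T' (n ∸ m))
T'-unfold n (suc zero) (s≤s ()) _
T'-unfold n m@(suc (suc _)) _ m<n
  rewrite ≢⇒≡ᵇ-false (<⇒≢ m<n) | >⇒≤ᵇ-false m<n =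
  cong suc (sum-cong (m ⊓ (n ∸ m)) _ _ λ x _ _ →
    T'fuel-irrelevant n (suc (n ∸ m)) (n ∸ m) x (∸-monoʳ-< (s≤s z≤n) (<⇒≤ m<n)) ≤-refl)

D-rec : ∀ m r → 1 < m → 1 ≤ r → D (m + r) m ≡ sumFrom1 (m ⊓ r) (D r)
D-rec m r 1<m 1≤r with D-unfold (m + r) m 1<m (m<m+n m 1≤r)
... | unfolded rewrite m+n∸m≡n m r = unfolded

T'-rec : ∀ m r → 1 < m → 1 ≤ r → T' (m + r) m ≡ 1 + sumFrom1 (m ⊓ r) (T' r)
T'-rec m r 1<m 1≤r with T'-unfold (m + r) m 1<m (m<m+n m 1≤r)
... | unfolded rewrite m+n∸m≡n m r = unfolded

D-diag : ∀ n → 1 ≤ n → D n n ≡ 1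
D-diag (suc zero)    _ = refl
D-diag (suc (suc j)) _ rewrite ≡ᵇ-refl (suc (suc j)) = refl

T'-diag : ∀ n → 1 ≤ n → T' n n ≡ 1
T'-diag (suc zero)    _ = refl
T'-diag (suc (suc j)) _ rewrite ≡ᵇ-refl (suc (suc j)) = refl

D-above : ∀ s x → s < x → D s x ≡ 0
D-above zero    (suc zero)    _ = refl
D-above (suc s) (suc zero)    (s≤s ())
D-above s       (suc (suc j)) s<x
  rewrite ≢⇒≡ᵇ-false (≢-sym (<⇒≢ s<x)) | ≤⇒≤ᵇ-true (<⇒≤ s<x) = refl

-- Since D(s,x) = 0 for x > s, truncating Σ_x D(s,x) at min(m,s+1) or at
-- min(m,s) gives the same sum.
sum-D-truncate : ∀ m s → sumFrom1 (m ⊓ suc s) (D s) ≡ sumFrom1 (m ⊓ s) (D s)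
sum-D-truncate m s = sum-extend (D s) (m ⊓ s) (m ⊓ suc s) (⊓-monoʳ-≤ m (n≤1+n s)) vanish
  where
  vanish : ∀ x → m ⊓ s < x → x ≤ m ⊓ suc s → D s x ≡ 0
  vanish x m⊓s<x x≤m⊓1+s = D-above s x (≰⇒> λ x≤s →
    <⇒≱ m⊓s<x (⊓-glb (m≤n⊓o⇒m≤n m (suc s) x≤m⊓1+s) x≤s))

D-pred : ∀ m r → 1 < m → D (m + suc r ∸ 1) m ≡ 1 + sumFrom1 (m ⊓ suc r) (dropFirst (D r))
D-pred m r 1<m = trans (cong (λ n → D (n ∸ 1) m) (+-suc m r)) (D-pred′ r)
  where
  D-pred′ : ∀ r → D (m + r) m ≡ 1 + sumFrom1 (m ⊓ suc r) (dropFirst (D r))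
  D-pred′ zero = begin
    D (m + 0) m  ≡⟨ cong (λ n → D n m) (+-identityʳ m) ⟩
    D m m        ≡⟨ D-diag m (<⇒≤ 1<m) ⟩
    1            ≡⟨ cong (λ k → 1 + sumFrom1 k (dropFirst (D 0))) (m≥n⇒m⊓n≡n (<⇒≤ 1<m)) ⟨
    1 + sumFrom1 (m ⊓ 1) (dropFirst (D 0))
      ∎
  D-pred′ (suc r) = begin
    D (m + suc r) m                         ≡⟨ D-rec m (suc r) 1<m (s≤s z≤n) ⟩
    sumFrom1 (m ⊓ suc r) (D (suc r))        ≡⟨ sum-D-truncate m (suc r) ⟨
    sumFrom1 (m ⊓ suc (suc r)) (D (suc r))  ≡⟨ sum-split-first _ (D (suc r)) 1≤k ⟩
    1 + sumFrom1 (m ⊓ suc (suc r)) (dropFirst (D (suc r)))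
      ∎
    where
    1≤k : 1 ≤ m ⊓ suc (suc r)
    1≤k = ⊓-glb (<⇒≤ 1<m) (s≤s z≤n)

Claim : ℕ → Set
Claim n = ∀ m → 1 < m → m ≤ n → T' n m ≡ D n m + D (n ∸ 1) m

claim-diagonal : ∀ m → 1 < m → T' m m ≡ D m m + D (m ∸ 1) m
claim-diagonal m 1<m
  rewrite T'-diag m (<⇒≤ 1<m) | D-diag m (<⇒≤ 1<m)
        | D-above (m ∸ 1) m (∸-monoʳ-< (s≤s z≤n) (<⇒≤ 1<m)) = refl

-- Termwise form of the claim at 1 + r, including the term x = 1 where
-- T'(1+r,1) = D(1+r,1) = 1.
T'-termwise : ∀ r → Claim (suc r) → ∀ x → 1 ≤ x → x ≤ suc r →
              T' (suc r) x ≡ D (suc r) x + dropFirst (D r) x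
T'-termwise r claim (suc zero)       _ _   = refl
T'-termwise r claim x@(suc (suc _)) _ x≤1+r = claim x (s≤s (s≤s z≤n)) x≤1+r

claim-off-diagonal : ∀ m r → 1 < m → Claim (suc r) →
                     T' (m + suc r) m ≡ D (m + suc r) m + D (m + suc r ∸ 1) m
claim-off-diagonal m r 1<m claim = begin
  T' (m + suc r) m
    ≡⟨ T'-rec m (suc r) 1<m (s≤s z≤n) ⟩
  1 + sumFrom1 k (T' (suc r))
    ≡⟨ cong suc (sum-cong k _ _ λ x 1≤x x≤k →
         T'-termwise r claim x 1≤x (≤-trans x≤k (m⊓n≤n m (suc r)))) ⟩
  1 + sumFrom1 k (λ x → D (suc r) x + dropFirst (D r) x)
    ≡⟨ cong suc (sum-+ k (D (suc r)) (dropFirst (D r))) ⟩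
  1 + (sumFrom1 k (D (suc r)) + sumFrom1 k (dropFirst (D r)))
    ≡⟨ +-suc (sumFrom1 k (D (suc r))) _ ⟨
  sumFrom1 k (D (suc r)) + (1 + sumFrom1 k (dropFirst (D r)))
    ≡⟨ cong₂ _+_ (D-rec m (suc r) 1<m (s≤s z≤n)) (D-pred m r 1<m) ⟨
  D (m + suc r) m + D (m + suc r ∸ 1) m
    ∎
  where
  k : ℕ
  k = m ⊓ suc r

claim-step : ∀ n → (∀ {s} → s < n → Claim s) → Claim n
claim-step n ih m 1<m m≤n with m≤n⇒∃[o]m+o≡n m≤n
... | zero  , refl rewrite +-identityʳ m = claim-diagonal m 1<m
... | suc r , refl = claim-off-diagonal m r 1<m (ih (m<n+m (suc r) (<⇒≤ 1<m)))

lemma2p2 : (n m : ℕ) → 1 < m → m ≤ n → T' n m ≡ D n m + D (n ∸ 1) m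
lemma2p2 = <-rec Claim claim-step
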